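{- Let $M=(m_{ij})\in\mathbb{Z}^{d\times d}$ with $m_{ii}=0$ for all $i$. Then the lattice $\Lambda_M=\{X\in K^{d\times d}:\mathrm{val}(x_{ij})\ge m_{ij}\ \forall i,j\}$ is an order in $K^{d\times d}$ if and only if $M\,\underline{\odot}\,M=M$, where $\underline{\odot}$ denotes the min-plus matrix product $(A\,\underline{\odot}\,B)_{ik}=\min_j(a_{ij}+b_{jk})$. In this case, the map $u\mapsto L_u$ induces a bijection between the integer points of the polytrope $$Q_M=\{u\in\mathbb{R}^d/\mathbb{R}\mathbf{1}:\ u_i-u_j\le m_{ij}\ \text{for } 1\le i,j\le d\}$$ (i.e.\ classes in $\mathbb{Z}^d/\mathbb{Z}\mathbf{1}$ satisfying these inequalities) and the isomorphism classes of $\Lambda_M$-lattices.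
   Context: $K$ is a field with a surjective discrete valuation $\mathrm{val}:K\to\mathbb{Z}\cup\{\infty\}$, $p\in K$ with $\mathrm{val}(p)=1$, and $\mathcal{O}_K$ its valuation ring. A lattice in a finite-dimensional $K$-vector space $V$ of dimension $n$ is a free $\mathcal{O}_K$-submodule of rank $n$. An order in $K^{d\times d}$ is a lattice in $K^{d\times d}$ which is also a subring (containing the identity). For $u\in\mathbb{Z}^d$, $L_u=\mathrm{diag}(p^{u_1},\dots,p^{u_d})\,\mathcal{O}_K^d$. $\mathbf{1}=(1,\dots,1)$. A $\Lambda_M$-lattice is a $\Lambda_M$-module that is also a lattice in $K^d$ (with $\Lambda_M$ acting by matrix multiplication). -}

module Defs where

open import Level using (Level; _⊔_) renaming (suc to lsuc)
open import Algebra.Bundles using (CommutativeRing)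
open import Data.Nat using (ℕ; zero; suc)
open import Data.Integer as ℤ using (ℤ; +_; -[1+_])
open import Data.Fin using (Fin; zero; suc)
open import Data.Fin.Properties using (_≟_)
open import Data.Product using (Σ; ∃; _×_; _,_)
open import Relation.Nullary using (¬_; yes; no)
open import Relation.Binary.PropositionalEquality using (_≡_)
open import Function.Bundles using (_⇔_)

data ℤ∞ : Set where
  fin : ℤ → ℤ∞
  ∞   : ℤ∞

infix 4 _≤∞_
data _≤∞_ : ℤ∞ → ℤ∞ → Set where
  fin≤fin : ∀ {a b} → a ℤ.≤ b → fin a ≤∞ fin b
  _≤∞∞    : ∀ a → a ≤∞ ∞

_+∞_ : ℤ∞ → ℤ∞ → ℤ∞
fin a +∞ fin b = fin (a ℤ.+ b)
fin a +∞ ∞     = ∞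
∞     +∞ _     = ∞

min∞ : ℤ∞ → ℤ∞ → ℤ∞
min∞ (fin a) (fin b) = fin (a ℤ.⊓ b)
min∞ (fin a) ∞       = fin a
min∞ ∞       y       = y

record DVField (c ℓ : Level) : Set (lsuc (c ⊔ ℓ)) where
  field
    cring : CommutativeRing c ℓ
  open CommutativeRing cring public
  field
    1≉0     : ¬ (1# ≈ 0#)
    inv     : Carrier → Carrier
    inv-r   : ∀ x → ¬ (x ≈ 0#) → x * inv x ≈ 1#
    val     : Carrier → ℤ∞
    val-cong : ∀ {x y} → x ≈ y → val x ≡ val y
    val-∞   : ∀ x → (val x ≡ ∞) ⇔ (x ≈ 0#)
    val-*   : ∀ x y → val (x * y) ≡ val x +∞ val y
    val-+   : ∀ x y → min∞ (val x) (val y) ≤∞ val (x + y)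
    val-surj : ∀ (n : ℤ) → ∃ λ x → val x ≡ fin n

-- min over Fin n (value at n = 0 is an irrelevant default, never used below
-- since it is only applied with n = d when indices i k : Fin d exist)
minFin : ∀ {n} → (Fin n → ℤ) → ℤ
minFin {zero}        f = + 0
minFin {suc zero}    f = f zero
minFin {suc (suc n)} f = f zero ℤ.⊓ minFin (λ j → f (suc j))

IntMat : ℕ → Set
IntMat d = Fin d → Fin d → ℤ

_⊙_ : ∀ {d} → IntMat d → IntMat d → IntMat d
(A ⊙ B) i k = minFin (λ j → A i j ℤ.+ B j k)

_≡ₘ_ : ∀ {d} → IntMat d → IntMat d → Set
A ≡ₘ B = ∀ i k → A i k ≡ B i k

-- integer points of the polytrope Q_M (representatives in ℤ^d)
InQ : ∀ {d} → IntMat d → (Fin d → ℤ) → Set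
InQ M u = ∀ i j → u i ℤ.- u j ℤ.≤ M i j

-- equality in ℤ^d / ℤ𝟏
_∼_ : ∀ {d} → (Fin d → ℤ) → (Fin d → ℤ) → Set
u ∼ v = ∃ λ (t : ℤ) → ∀ i → u i ≡ v i ℤ.+ t

module _ {c ℓ : Level} (K : DVField c ℓ) where
  open DVField K using (Carrier; _≈_; _+_; _*_; 0#; 1#; inv; val)

  O : Carrier → Set
  O x = fin (+ 0) ≤∞ val x

  pow : Carrier → ℕ → Carrier
  pow x zero    = 1#
  pow x (suc n) = x * pow x n

  zpow : Carrier → ℤ → Carrier
  zpow p (+ n)      = pow p n
  zpow p -[1+ n ]   = pow (inv p) (suc n)

  SumFin : ∀ n → (Fin n → Carrier) → Carrier
  SumFin zero    f = 0#
  SumFin (suc n) f = f zero + SumFin n (λ j → f (suc j))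

  Vec : ℕ → Set c
  Vec d = Fin d → Carrier

  Mat : ℕ → Set c
  Mat d = Fin d → Fin d → Carrier

  _≈v_ : ∀ {d} → Vec d → Vec d → Set ℓ
  x ≈v y = ∀ i → x i ≈ y i

  _+v_ : ∀ {d} → Vec d → Vec d → Vec d
  (x +v y) i = x i + y i

  _≈m_ : ∀ {d} → Mat d → Mat d → Set ℓ
  X ≈m Y = ∀ i j → X i j ≈ Y i j

  _·m_ : ∀ {d} → Mat d → Mat d → Mat d
  _·m_ {d} X Y i k = SumFin d (λ j → X i j * Y j k)

  _·v_ : ∀ {d} → Mat d → Vec d → Vec d
  _·v_ {d} X x i = SumFin d (λ j → X i j * x j)

  idMat : ∀ {d} → Mat d
  idMat i j with i ≟ j
  ... | yes _ = 1#
  ... | no  _ = 0#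

  -- Lattice in K^d: a free 𝒪_K-submodule of rank d, i.e. it has an
  -- 𝒪_K-basis b_1..b_d: its elements are exactly the 𝒪_K-combinations
  -- of b, and such combinations are unique (𝒪_K-linear independence).
  IsLattice : ∀ d → (Vec d → Set (c ⊔ ℓ)) → Set (c ⊔ ℓ)
  IsLattice d L = Σ (Fin d → Vec d) λ b →
      (∀ x → L x ⇔ (∃ λ (a : Fin d → Carrier) → (∀ i → O (a i)) ×
                      (x ≈v (λ k → SumFin d (λ i → a i * b i k)))))
    × (∀ (a : Fin d → Carrier) → (∀ i → O (a i)) →
          (∀ k → SumFin d (λ i → a i * b i k) ≈ 0#) → ∀ i → a i ≈ 0#)

  IsMatLattice : ∀ d → (Mat d → Set (c ⊔ ℓ)) → Set (c ⊔ ℓ)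
  IsMatLattice d L = Σ (Fin d → Fin d → Mat d) λ b →
      (∀ X → L X ⇔ (∃ λ (a : Mat d) → (∀ i j → O (a i j)) ×
          (X ≈m (λ k l → SumFin d (λ i → SumFin d (λ j → a i j * b i j k l))))))
    × (∀ (a : Mat d) → (∀ i j → O (a i j)) →
          (∀ k l → SumFin d (λ i → SumFin d (λ j → a i j * b i j k l)) ≈ 0#) →
          ∀ i j → a i j ≈ 0#)

  IsOrder : ∀ d → (Mat d → Set (c ⊔ ℓ)) → Set (c ⊔ ℓ)
  IsOrder d Λ = IsMatLattice d Λ
    × (∀ X Y → Λ X → Λ Y → Λ (X ·m Y))
    × Λ idMat

  ΛM : ∀ {d} → IntMat d → Mat d → Set (c ⊔ ℓ)
  ΛM M X = Level.Lift (c ⊔ ℓ) (∀ i j → fin (M i j) ≤∞ val (X i j))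

  IsΛLattice : ∀ d → (Mat d → Set (c ⊔ ℓ)) → (Vec d → Set (c ⊔ ℓ)) → Set (c ⊔ ℓ)
  IsΛLattice d Λ L = IsLattice d L × (∀ X x → Λ X → L x → L (X ·v x))

  Lu : ∀ {d} → Carrier → (Fin d → ℤ) → Vec d → Set (c ⊔ ℓ)
  Lu {d} p u x = ∃ λ (a : Vec d) → (∀ i → O (a i)) × (∀ i → x i ≈ zpow p (u i) * a i)

  record ΛIso {d} (Λ : Mat d → Set (c ⊔ ℓ)) (L L' : Vec d → Set (c ⊔ ℓ)) : Set (c ⊔ ℓ) where
    field
      f     : ∀ x → L x → Vec d
      f∈    : ∀ x (lx : L x) → L' (f x lx)
      g     : ∀ y → L' y → Vec d
      g∈    : ∀ y (ly : L' y) → L (g y ly)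
      f-cong : ∀ x y (lx : L x) (ly : L y) → x ≈v y → f x lx ≈v f y ly
      g-cong : ∀ x y (lx : L' x) (ly : L' y) → x ≈v y → g x lx ≈v g y ly
      f-+   : ∀ x y (lx : L x) (ly : L y) (lxy : L (x +v y)) →
                f (x +v y) lxy ≈v (f x lx +v f y ly)
      f-Λ   : ∀ X x → Λ X → (lx : L x) (lXx : L (X ·v x)) →
                f (X ·v x) lXx ≈v (X ·v f x lx)
      gf    : ∀ x (lx : L x) → g (f x lx) (f∈ x lx) ≈v x
      fg    : ∀ y (ly : L' y) → f (g y ly) (g∈ y ly) ≈v y

{-# OPTIONS --safe #-}
-- Λ_M is spanned over 𝒪_K by the matrices p^{mᵢⱼ}Eᵢⱼ, and p^{mᵢⱼ}Eᵢⱼ · p^{mⱼₖ}Eⱼₖ = p^{mᵢⱼ+mⱼₖ}Eᵢₖ;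
-- so Λ_M is closed under products iff mᵢₖ ≤ mᵢⱼ + mⱼₖ, which for a zero diagonal means
-- M ⊙ M = M. The same computation shows that L_u is Λ_M-stable iff u ∈ Q_M.
-- A Λ_M-lattice L equals L_u, where uᵢ is the least valuation of an i-th coordinate in L:
-- ⊆ is clear, and ⊇ because 𝒪_K Eᵢᵢ ⊆ Λ_M moves a vector of L whose i-th coordinate has
-- valuation uᵢ onto any i-th coordinate of valuation ≥ uᵢ. (Such a vector exists: if all
-- i-th coordinates vanished, the matrices p^{mᵢₗ}Eᵢₗ would kill all of L.)
-- Finally a Λ_M-isomorphism f : L_u → L_v commutes with the Eᵢⱼ, so val f(p^{uᵢ}eᵢ)ᵢ = vᵢ
-- and p^{mᵢⱼ} f(p^{uⱼ}eⱼ)ⱼ = p^{mᵢⱼ+uⱼ−uᵢ} f(p^{uᵢ}eᵢ)ᵢ, whence uᵢ − vᵢ does not depend on i.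
module Submission where

open import Defs
open import Level using (Level; _⊔_; lift; lower)
open import Data.Nat using (ℕ; zero; suc)
open import Data.Integer as ℤ using (ℤ; +_; -[1+_])
import Data.Integer.Properties as ℤP
open import Data.Integer.Tactic.RingSolver using (solve-∀)
open import Data.Fin using (Fin; zero; suc)
open import Data.Fin.Properties using (_≟_; suc-injective)
open import Data.Product using (∃; _×_; _,_; proj₁; proj₂)
open import Data.Sum using (_⊎_; inj₁; inj₂)
open import Data.Empty using (⊥-elim)
open import Relation.Nullary using (¬_; yes; no)
import Relation.Binary.PropositionalEquality as ≡
open ≡ using (_≡_; _≢_)
open import Function.Base using (_∘_)
open import Function.Bundles using (_⇔_; mk⇔; Equivalence)
import Algebra.Properties.Semiring.Sum as SemiringSum
import Relation.Binary.Reasoning.Setoid as SetoidReasoning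

≤∞-refl : ∀ {x} → x ≤∞ x
≤∞-refl {fin a} = fin≤fin ℤP.≤-refl
≤∞-refl {∞}     = ∞ ≤∞∞

≤∞-reflexive : ∀ {x y} → x ≡ y → x ≤∞ y
≤∞-reflexive ≡.refl = ≤∞-refl

≤∞-trans : ∀ {x y z} → x ≤∞ y → y ≤∞ z → x ≤∞ z
≤∞-trans (fin≤fin p) (fin≤fin q) = fin≤fin (ℤP.≤-trans p q)
≤∞-trans _           (_ ≤∞∞)     = _ ≤∞∞

∞≤⇒≡∞ : ∀ {x} → ∞ ≤∞ x → x ≡ ∞
∞≤⇒≡∞ (.∞ ≤∞∞) = ≡.refl

≤∞-antisym : ∀ {x y} → x ≤∞ y → y ≤∞ x → x ≡ y
≤∞-antisym (fin≤fin p) (fin≤fin q) = ≡.cong fin (ℤP.≤-antisym p q)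
≤∞-antisym (_ ≤∞∞)     q           = ∞≤⇒≡∞ q

≤∞-total : ∀ x y → x ≤∞ y ⊎ y ≤∞ x
≤∞-total (fin a) (fin b) with ℤP.≤-total a b
... | inj₁ a≤b = inj₁ (fin≤fin a≤b)
... | inj₂ b≤a = inj₂ (fin≤fin b≤a)
≤∞-total x       ∞       = inj₁ (x ≤∞∞)
≤∞-total ∞       (fin b) = inj₂ (fin b ≤∞∞)

fin-injective : ∀ {a b} → fin a ≡ fin b → a ≡ b
fin-injective ≡.refl = ≡.refl

fin≤fin⁻¹ : ∀ {a b} → fin a ≤∞ fin b → a ℤ.≤ b
fin≤fin⁻¹ (fin≤fin a≤b) = a≤b

ℤ∞-finite : ∀ x → x ≢ ∞ → ∃ λ n → x ≡ fin n
ℤ∞-finite (fin n) _   = n , ≡.refl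
ℤ∞-finite ∞       x≢∞ = ⊥-elim (x≢∞ ≡.refl)

min∞-glb : ∀ {x y z} → z ≤∞ x → z ≤∞ y → z ≤∞ min∞ x y
min∞-glb (fin≤fin p) (fin≤fin q) = fin≤fin (ℤP.⊓-glb p q)
min∞-glb (fin≤fin p) (_ ≤∞∞)     = fin≤fin p
min∞-glb (_ ≤∞∞)     q           = q

+∞-mono-≤∞ : ∀ {a a′ b b′} → a ≤∞ a′ → b ≤∞ b′ → a +∞ b ≤∞ a′ +∞ b′
+∞-mono-≤∞ (fin≤fin p) (fin≤fin q) = fin≤fin (ℤP.+-mono-≤ p q)
+∞-mono-≤∞ (fin≤fin p) (_ ≤∞∞)     = _ ≤∞∞
+∞-mono-≤∞ (_ ≤∞∞)     q           = _ ≤∞∞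

≤∞-+∞ˡ : ∀ {s a} → fin (+ 0) ≤∞ s → a ≤∞ s +∞ a
≤∞-+∞ˡ {fin s} {fin a} (fin≤fin 0≤s) =
  fin≤fin (≡.subst (ℤ._≤ s ℤ.+ a) (ℤP.+-identityˡ a) (ℤP.+-monoˡ-≤ a 0≤s))
≤∞-+∞ˡ {fin s} {∞} _ = ∞ ≤∞∞
≤∞-+∞ˡ {∞}     {a} _ = a ≤∞∞

argmin : ∀ {n} → Fin n → (g : Fin n → ℤ∞) → ∃ λ j → ∀ k → g j ≤∞ g k
argmin {suc zero}    _ g = zero , λ { zero → ≤∞-refl }
argmin {suc (suc n)} _ g with argmin zero (g ∘ suc)
... | j , j-min with ≤∞-total (g zero) (g (suc j))
... | inj₁ g0≤gj = zero  , λ { zero → ≤∞-refl ; (suc k) → ≤∞-trans g0≤gj (j-min k) }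
... | inj₂ gj≤g0 = suc j , λ { zero → gj≤g0    ; (suc k) → j-min k }

minFin-≤ : ∀ {n} (f : Fin n → ℤ) j → minFin f ℤ.≤ f j
minFin-≤ {suc zero}    f zero    = ℤP.≤-refl
minFin-≤ {suc (suc n)} f zero    = ℤP.i⊓j≤i _ _
minFin-≤ {suc (suc n)} f (suc j) = ℤP.≤-trans (ℤP.i⊓j≤j _ _) (minFin-≤ (f ∘ suc) j)

minFin-glb : ∀ {n} (f : Fin n → ℤ) {a} → Fin n → (∀ j → a ℤ.≤ f j) → a ℤ.≤ minFin f
minFin-glb {suc zero}    f _ a≤f = a≤f zero
minFin-glb {suc (suc n)} f _ a≤f =
  ℤP.⊓-glb (a≤f zero) (minFin-glb (f ∘ suc) zero (a≤f ∘ suc))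

-≤⇒≤+ : ∀ {a b c} → a ℤ.- b ℤ.≤ c → a ℤ.≤ c ℤ.+ b
-≤⇒≤+ {a} {b} {c} a-b≤c = ≡.subst (ℤ._≤ c ℤ.+ b) (cancel a b) (ℤP.+-monoˡ-≤ b a-b≤c)
  where
  cancel : ∀ a b → (a ℤ.- b) ℤ.+ b ≡ a
  cancel = solve-∀

≤+⇒-≤ : ∀ {a b c} → a ℤ.≤ c ℤ.+ b → a ℤ.- b ℤ.≤ c
≤+⇒-≤ {a} {b} {c} a≤c+b = ≡.subst (a ℤ.- b ℤ.≤_) (cancel c b) (ℤP.+-monoˡ-≤ (ℤ.- b) a≤c+b)
  where
  cancel : ∀ c b → (c ℤ.+ b) ℤ.- b ≡ c
  cancel = solve-∀

a+a≡a⇒a≡0 : ∀ a → a ℤ.+ a ≡ a → a ≡ + 0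
a+a≡a⇒a≡0 a a+a≡a = begin
  a                   ≡⟨ cancel a ⟩
  (a ℤ.+ a) ℤ.- a     ≡⟨ ≡.cong (ℤ._- a) a+a≡a ⟩
  a ℤ.- a             ≡⟨ ℤP.+-inverseʳ a ⟩
  + 0                 ∎
  where
  open ≡.≡-Reasoning
  cancel : ∀ a → a ≡ (a ℤ.+ a) ℤ.- a
  cancel = solve-∀

a+b≡0⇒b≡-a : ∀ a b → a ℤ.+ b ≡ + 0 → b ≡ ℤ.- a
a+b≡0⇒b≡-a a b a+b≡0 = begin
  b                       ≡⟨ cancel a b ⟩
  ℤ.- a ℤ.+ (a ℤ.+ b)     ≡⟨ ≡.cong (ℤ._+_ (ℤ.- a)) a+b≡0 ⟩
  ℤ.- a ℤ.+ + 0           ≡⟨ ℤP.+-identityʳ (ℤ.- a) ⟩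
  ℤ.- a                   ∎
  where
  open ≡.≡-Reasoning
  cancel : ∀ a b → b ≡ ℤ.- a ℤ.+ (a ℤ.+ b)
  cancel = solve-∀

differences-equal : ∀ ui vi uj vj m →
  m ℤ.+ vj ≡ (ℤ.- ui ℤ.+ (m ℤ.+ uj)) ℤ.+ vi → ui ℤ.- vi ≡ uj ℤ.- vj
differences-equal ui vi uj vj m eq = ≡.sym (begin
  uj ℤ.- vj                                                            ≡⟨ shift ui vi uj vj m ⟩
  (ui ℤ.- vi) ℤ.+ (((ℤ.- ui ℤ.+ (m ℤ.+ uj)) ℤ.+ vi) ℤ.- (m ℤ.+ vj))
    ≡⟨ ≡.cong (ℤ._+_ (ui ℤ.- vi)) (ℤP.i≡j⇒i-j≡0 (≡.sym eq)) ⟩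
  (ui ℤ.- vi) ℤ.+ + 0                                                  ≡⟨ ℤP.+-identityʳ _ ⟩
  ui ℤ.- vi                                                            ∎)
  where
  open ≡.≡-Reasoning
  shift : ∀ ui vi uj vj m →
    uj ℤ.- vj ≡ (ui ℤ.- vi) ℤ.+ (((ℤ.- ui ℤ.+ (m ℤ.+ uj)) ℤ.+ vi) ℤ.- (m ℤ.+ vj))
  shift = solve-∀

constant-difference⇒∼ : ∀ {n} (u v : Fin n → ℤ) → (∀ i j → u i ℤ.- v i ≡ u j ℤ.- v j) → u ∼ v
constant-difference⇒∼ {zero}  u v _    = + 0 , λ ()
constant-difference⇒∼ {suc n} u v diff = u zero ℤ.- v zero , λ i →
  ≡.trans (split (u i) (v i)) (≡.cong (ℤ._+_ (v i)) (diff i zero))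
  where
  split : ∀ a b → a ≡ b ℤ.+ (a ℤ.- b)
  split = solve-∀

module Theory {c ℓ : Level} (K : DVField c ℓ) where

  open DVField K hiding (zero)
  open Equivalence using (to; from)
  open SemiringSum semiring using (sum; sum-cong-≋; ∑-distrib-+; *-distribˡ-sum)

  infix  4 _≈ᵥ_
  infixr 7 _·ᵥ_ _·ₘ_

  _≈ᵥ_ : ∀ {d} → Vec K d → Vec K d → Set ℓ
  _≈ᵥ_ = _≈v_ K

  _·ᵥ_ : ∀ {d} → Mat K d → Vec K d → Vec K d
  _·ᵥ_ = _·v_ K

  _·ₘ_ : ∀ {d} → Mat K d → Mat K d → Mat K d
  _·ₘ_ = _·m_ K

  ∑ : ∀ n → (Fin n → Carrier) → Carrier
  ∑ = SumFin K

  val-≈0 : ∀ {x} → x ≈ 0# → val x ≡ ∞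
  val-≈0 {x} = from (val-∞ x)

  ≈0⇒≤∞-val : ∀ {a x} → x ≈ 0# → a ≤∞ val x
  ≈0⇒≤∞-val {a} x≈0 rewrite val-≈0 x≈0 = a ≤∞∞

  val-fin⇒≉0 : ∀ {x n} → val x ≡ fin n → ¬ x ≈ 0#
  val-fin⇒≉0 vx x≈0 with ≡.trans (≡.sym vx) (val-≈0 x≈0)
  ... | ()

  val-*-fin : ∀ {x y a b} → val x ≡ fin a → val y ≡ fin b → val (x * y) ≡ fin (a ℤ.+ b)
  val-*-fin {x} {y} vx vy = ≡.trans (val-* x y) (≡.cong₂ _+∞_ vx vy)

  x*y≈0⇒x≈0 : ∀ {x y} → x * y ≈ 0# → ¬ y ≈ 0# → x ≈ 0#
  x*y≈0⇒x≈0 {x} {y} xy≈0 y≉0 with val x in vx | val y in vy | ≡.trans (≡.sym (val-* x y)) (val-≈0 xy≈0)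
  ... | ∞     | _     | _  = to (val-∞ x) vx
  ... | fin _ | ∞     | _  = ⊥-elim (y≉0 (to (val-∞ y) vy))
  ... | fin _ | fin _ | ()

  val-1# : val 1# ≡ fin (+ 0)
  val-1# with val 1# in v1
  ... | ∞     = ⊥-elim (1≉0 (to (val-∞ 1#) v1))
  ... | fin a = ≡.cong fin (a+a≡a⇒a≡0 a (fin-injective
      (≡.trans (≡.sym (val-*-fin v1 v1)) (≡.trans (val-cong (*-identityˡ 1#)) v1))))

  O-1# : O K 1#
  O-1# = ≤∞-reflexive (≡.sym val-1#)

  val-x+val-inv-x : ∀ {x} → ¬ x ≈ 0# → val x +∞ val (inv x) ≡ fin (+ 0)
  val-x+val-inv-x {x} x≉0 = ≡.trans (≡.sym (val-* x (inv x))) (≡.trans (val-cong (inv-r x x≉0)) val-1#)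

  val-inv : ∀ {x n} → val x ≡ fin n → val (inv x) ≡ fin (ℤ.- n)
  val-inv {x} {n} vx
    with val (inv x) | ≡.trans (≡.cong (_+∞ val (inv x)) (≡.sym vx)) (val-x+val-inv-x (val-fin⇒≉0 vx))
  ... | ∞     | ()
  ... | fin m | n+m≡0 = ≡.cong fin (a+b≡0⇒b≡-a n m (fin-injective n+m≡0))

  *-inv-cancelˡ : ∀ {x} y → ¬ x ≈ 0# → x * (inv x * y) ≈ y
  *-inv-cancelˡ {x} y x≉0 = begin
    x * (inv x * y)  ≈⟨ *-assoc x (inv x) y ⟨
    (x * inv x) * y  ≈⟨ *-congʳ (inv-r x x≉0) ⟩
    1# * y           ≈⟨ *-identityˡ y ⟩
    y                ∎
    where open SetoidReasoning setoid

  *-inv-cancelʳ : ∀ {x} y → ¬ x ≈ 0# → (inv x * y) * x ≈ y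
  *-inv-cancelʳ {x} y x≉0 = trans (*-comm _ x) (*-inv-cancelˡ y x≉0)

  inv-*-cancel : ∀ {x} y → ¬ x ≈ 0# → inv x * (x * y) ≈ y
  inv-*-cancel {x} y x≉0 =
    trans (sym (*-assoc _ _ _)) (trans (*-congʳ (*-comm _ _)) (trans (*-assoc _ _ _) (*-inv-cancelˡ y x≉0)))

  val-*-≥ : ∀ {a b x y} → fin a ≤∞ val x → fin b ≤∞ val y → fin (a ℤ.+ b) ≤∞ val (x * y)
  val-*-≥ {x = x} {y} a≤x b≤y rewrite val-* x y = +∞-mono-≤∞ a≤x b≤y

  O-*-≥ : ∀ {a s y} → O K s → a ≤∞ val y → a ≤∞ val (s * y)
  O-*-≥ {s = s} {y} s∈O a≤y rewrite val-* s y = ≤∞-trans a≤y (≤∞-+∞ˡ s∈O)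

  inv-*-∈O : ∀ {x y n} → val x ≡ fin n → fin n ≤∞ val y → O K (inv x * y)
  inv-*-∈O {x} {y} {n} vx n≤y rewrite val-* (inv x) y | val-inv vx =
    ≤∞-trans (≤∞-reflexive (≡.cong fin (≡.sym (ℤP.+-inverseˡ n))))
             (+∞-mono-≤∞ (≤∞-refl {fin (ℤ.- n)}) n≤y)

  ∑≡sum : ∀ n (f : Fin n → Carrier) → ∑ n f ≡ sum f
  ∑≡sum zero    f = ≡.refl
  ∑≡sum (suc n) f = ≡.cong (_+_ (f zero)) (∑≡sum n (f ∘ suc))

  ∑-cong : ∀ {n} {f g : Fin n → Carrier} → (∀ j → f j ≈ g j) → ∑ n f ≈ ∑ n g
  ∑-cong {n} {f} {g} f≈g = ≡.subst₂ _≈_ (≡.sym (∑≡sum n f)) (≡.sym (∑≡sum n g)) (sum-cong-≋ f≈g)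

  ∑-+ : ∀ {n} (f g : Fin n → Carrier) → ∑ n (λ j → f j + g j) ≈ ∑ n f + ∑ n g
  ∑-+ {n} f g = ≡.subst₂ _≈_ (≡.sym (∑≡sum n _)) (≡.sym (≡.cong₂ _+_ (∑≡sum n f) (∑≡sum n g)))
    (∑-distrib-+ f g)

  ∑-*ˡ : ∀ {n} a (f : Fin n → Carrier) → ∑ n (λ j → a * f j) ≈ a * ∑ n f
  ∑-*ˡ {n} a f = ≡.subst₂ _≈_ (≡.sym (∑≡sum n _)) (≡.sym (≡.cong (a *_) (∑≡sum n f)))
    (sym (*-distribˡ-sum a f))

  ∑-zero : ∀ {n} {f : Fin n → Carrier} → (∀ j → f j ≈ 0#) → ∑ n f ≈ 0#
  ∑-zero {zero}  _   = refl
  ∑-zero {suc n} f≈0 = trans (+-cong (f≈0 zero) (∑-zero (f≈0 ∘ suc))) (+-identityˡ 0#)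

  ∑-single : ∀ {n} {f : Fin n → Carrier} j → (∀ k → k ≢ j → f k ≈ 0#) → ∑ n f ≈ f j
  ∑-single {suc n} zero    f≈0 = trans (+-congˡ (∑-zero (λ k → f≈0 (suc k) λ ()))) (+-identityʳ _)
  ∑-single {suc n} (suc j) f≈0 = trans (+-congʳ (f≈0 zero λ ())) (trans (+-identityˡ _)
    (∑-single j (λ k k≢j → f≈0 (suc k) (k≢j ∘ suc-injective))))

  val-∑-≥ : ∀ {n a} (f : Fin n → Carrier) → (∀ j → a ≤∞ val (f j)) → a ≤∞ val (∑ n f)
  val-∑-≥ {zero}  f _   = ≈0⇒≤∞-val refl
  val-∑-≥ {suc n} f a≤f = ≤∞-trans (min∞-glb (a≤f zero) (val-∑-≥ (f ∘ suc) (a≤f ∘ suc))) (val-+ _ _)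

  -- e i w is the vector w·eᵢ, and E i j α below the matrix α·Eᵢⱼ.
  e : ∀ {d} → Fin d → Carrier → Vec K d
  e i w k with k ≟ i
  ... | yes _ = w
  ... | no  _ = 0#

  e-on : ∀ {d} (i : Fin d) w → e i w i ≈ w
  e-on i w with i ≟ i
  ... | yes _   = refl
  ... | no  i≢i = ⊥-elim (i≢i ≡.refl)

  e-off : ∀ {d} {i k : Fin d} w → k ≢ i → e i w k ≈ 0#
  e-off {i = i} {k} w k≢i with k ≟ i
  ... | yes k≡i = ⊥-elim (k≢i k≡i)
  ... | no  _   = refl

  e-cong : ∀ {d} (i : Fin d) {w w′} → w ≈ w′ → e i w ≈ᵥ e i w′
  e-cong i w≈w′ k with k ≟ i
  ... | yes _ = w≈w′
  ... | no  _ = refl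

  e-∈O : ∀ {d} (i k : Fin d) {w} → O K w → O K (e i w k)
  e-∈O i k w∈O with k ≟ i
  ... | yes _ = w∈O
  ... | no  _ = ≈0⇒≤∞-val refl

  ∑-e : ∀ {d} (w : Vec K d) k → ∑ d (λ i → e i (w i) k) ≈ w k
  ∑-e w k = trans (∑-single k (λ i i≢k → e-off (w i) (i≢k ∘ ≡.sym))) (e-on k (w k))

  ∑-*-e : ∀ {d} (a w : Vec K d) k → ∑ d (λ i → a i * e i (w i) k) ≈ a k * w k
  ∑-*-e a w k = trans (∑-single k (λ i i≢k → trans (*-congˡ (e-off (w i) (i≢k ∘ ≡.sym))) (zeroʳ (a i))))
    (*-congˡ (e-on k (w k)))

  ∑-e-* : ∀ {d} (j : Fin d) α (x : Vec K d) → ∑ d (λ l → e j α l * x l) ≈ α * x j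
  ∑-e-* j α x = trans (∑-single j (λ l l≢j → trans (*-congʳ (e-off α l≢j)) (zeroˡ (x l))))
    (*-congʳ (e-on j α))

  E : ∀ {d} → Fin d → Fin d → Carrier → Mat K d
  E i j α k l = e i (e j α l) k

  E-at : ∀ {d} (i j : Fin d) α → E i j α i j ≈ α
  E-at i j α = trans (e-on i _) (e-on j α)

  E-·ᵥ : ∀ {d} (i j : Fin d) α x → E i j α ·ᵥ x ≈ᵥ e i (α * x j)
  E-·ᵥ i j α x k with k ≟ i
  ... | yes _ = ∑-e-* j α x
  ... | no  _ = ∑-zero (λ l → zeroˡ (x l))

  E-·ᵥ-row : ∀ {d} (i j : Fin d) α x → (E i j α ·ᵥ x) i ≈ α * x j
  E-·ᵥ-row i j α x = trans (E-·ᵥ i j α x i) (e-on i _)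

  E-·ₘ-row : ∀ {d} (i j : Fin d) α (Y : Mat K d) k → (E i j α ·ₘ Y) i k ≈ α * Y j k
  E-·ₘ-row i j α Y k =
    trans (∑-cong {g = λ l → e j α l * Y l k} (λ l → *-congʳ (e-on i _))) (∑-e-* j α (λ l → Y l k))

  ∑∑-*-E : ∀ {d} (a w : Mat K d) k l →
    ∑ d (λ i → ∑ d (λ j → a i j * E i j (w i j) k l)) ≈ a k l * w k l
  ∑∑-*-E {d} a w k l = trans (∑-single k row-zero) (trans (∑-single l entry-zero) (*-congˡ (E-at k l _)))
    where
    row-zero : ∀ i → i ≢ k → ∑ d (λ j → a i j * E i j (w i j) k l) ≈ 0#
    row-zero i i≢k = ∑-zero {f = λ j → a i j * E i j (w i j) k l}
      (λ j → trans (*-congˡ (e-off _ (i≢k ∘ ≡.sym))) (zeroʳ _))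
    entry-zero : ∀ j → j ≢ l → a k j * E k j (w k j) k l ≈ 0#
    entry-zero j j≢l = trans (*-congˡ (trans (e-on k _) (e-off _ (j≢l ∘ ≡.sym)))) (zeroʳ _)

  Spans : ∀ {d} → (Vec K d → Set (c ⊔ ℓ)) → (Fin d → Vec K d) → Set (c ⊔ ℓ)
  Spans {d} L b = ∀ x → L x ⇔ (∃ λ (a : Fin d → Carrier) → (∀ i → O K (a i)) ×
                                  (x ≈ᵥ (λ k → ∑ d (λ i → a i * b i k))))

  module _ {d} {L : Vec K d → Set (c ⊔ ℓ)} {b : Fin d → Vec K d} (span : Spans L b) where

    ∈-resp-≈ᵥ : ∀ {x y} → x ≈ᵥ y → L x → L y
    ∈-resp-≈ᵥ {x} {y} x≈y x∈ with to (span x) x∈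
    ... | a , a∈O , x≈ = from (span y) (a , a∈O , λ k → trans (sym (x≈y k)) (x≈ k))

    0∈ : L (λ _ → 0#)
    0∈ = from (span _)
      ((λ _ → 0#) , (λ _ → ≈0⇒≤∞-val refl) , λ k → sym (∑-zero (λ i → zeroˡ (b i k))))

    +-closed : ∀ {x y} → L x → L y → L (_+v_ K x y)
    +-closed {x} {y} x∈ y∈ with to (span x) x∈ | to (span y) y∈
    ... | a , a∈O , x≈ | a′ , a′∈O , y≈ = from (span _)
      ( (λ i → a i + a′ i)
      , (λ i → ≤∞-trans (min∞-glb (a∈O i) (a′∈O i)) (val-+ (a i) (a′ i)))
      , λ k → trans (+-cong (x≈ k) (y≈ k))
          (trans (sym (∑-+ (λ i → a i * b i k) (λ i → a′ i * b i k)))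
                 (∑-cong (λ i → sym (distribʳ (b i k) (a i) (a′ i))))))

    ∑-closed : ∀ n (ys : Fin n → Vec K d) → (∀ i → L (ys i)) → L (λ k → ∑ n (λ i → ys i k))
    ∑-closed zero    ys _   = 0∈
    ∑-closed (suc n) ys ys∈ = +-closed (ys∈ zero) (∑-closed n (ys ∘ suc) (ys∈ ∘ suc))

    basis∈ : ∀ j → L (b j)
    basis∈ j = from (span (b j))
      (e j 1# , (λ i → e-∈O j i O-1#) , λ k → sym (trans (∑-e-* j 1# (λ i → b i k)) (*-identityˡ (b j k))))

    coordinate-≥ : ∀ {i a} → (∀ j → a ≤∞ val (b j i)) → ∀ {x} → L x → a ≤∞ val (x i)
    coordinate-≥ {i} a≤b {x} x∈ with to (span x) x∈
    ... | a , a∈O , x≈ = ≡.subst (_ ≤∞_) (≡.sym (val-cong (x≈ i)))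
      (val-∑-≥ _ (λ j → O-*-≥ (a∈O j) (a≤b j)))

  lattice-nonzero : ∀ {d L} → IsLattice K d L → Fin d → ¬ (∀ x → L x → x ≈ᵥ (λ _ → 0#))
  lattice-nonzero (b , span , independent) i all-zero = 1≉0 (independent (λ _ → 1#) (λ _ → O-1#) sums-zero i)
    where
    sums-zero : ∀ k → ∑ _ (λ j → 1# * b j k) ≈ 0#
    sums-zero k = ∑-zero (λ j → trans (*-identityˡ _) (all-zero (b j) (basis∈ span j) k))

  ⊆⊇⇒ΛIso : ∀ {d} {Λ : Mat K d → Set (c ⊔ ℓ)} {L L′ : Vec K d → Set (c ⊔ ℓ)} →
    (∀ x → L x → L′ x) → (∀ x → L′ x → L x) → ΛIso K Λ L L′
  ⊆⊇⇒ΛIso L⊆L′ L′⊆L = record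
    { f = λ x _ → x ; f∈ = L⊆L′ ; g = λ y _ → y ; g∈ = L′⊆L
    ; f-cong = λ _ _ _ _ x≈y → x≈y ; g-cong = λ _ _ _ _ x≈y → x≈y
    ; f-+ = λ _ _ _ _ _ _ → refl ; f-Λ = λ _ _ _ _ _ _ → refl
    ; gf = λ _ _ _ → refl ; fg = λ _ _ _ → refl
    }

  scaling-ΛIso : ∀ {d} {Λ : Mat K d → Set (c ⊔ ℓ)} {L L′ : Vec K d → Set (c ⊔ ℓ)} {s} → ¬ s ≈ 0# →
    (∀ x → L x → L′ (λ i → s * x i)) → (∀ y → L′ y → L (λ i → inv s * y i)) → ΛIso K Λ L L′
  scaling-ΛIso {s = s} s≉0 sL⊆L′ s⁻¹L′⊆L = record
    { f = λ x _ i → s * x i ; f∈ = sL⊆L′ ; g = λ y _ i → inv s * y i ; g∈ = s⁻¹L′⊆L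
    ; f-cong = λ _ _ _ _ x≈y i → *-congˡ (x≈y i) ; g-cong = λ _ _ _ _ x≈y i → *-congˡ (x≈y i)
    ; f-+ = λ x y _ _ _ i → distribˡ s (x i) (y i)
    ; f-Λ = λ X x _ _ _ i → trans (sym (∑-*ˡ s (λ j → X i j * x j))) (∑-cong (λ j → swap (X i j) (x j)))
    ; gf = λ x _ i → inv-*-cancel (x i) s≉0
    ; fg = λ y _ i → *-inv-cancelˡ (y i) s≉0
    }
    where
    swap : ∀ a x → s * (a * x) ≈ a * (s * x)
    swap a x = trans (sym (*-assoc s a x)) (trans (*-congʳ (*-comm s a)) (*-assoc a s x))

  module _ {d} (M : IntMat d) where

    E∈ΛM : ∀ {i j α} → fin (M i j) ≤∞ val α → ΛM K M (E i j α)
    E∈ΛM {i} {j} {α} M≤α = lift entry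
      where
      entry : ∀ k l → fin (M k l) ≤∞ val (E i j α k l)
      entry k l with k ≟ i | l ≟ j
      ... | yes ≡.refl | yes ≡.refl = M≤α
      ... | yes ≡.refl | no  _      = ≈0⇒≤∞-val refl
      ... | no  _      | _          = ≈0⇒≤∞-val refl

    E-diag∈ΛM : ∀ {i s} → M i i ≡ + 0 → O K s → ΛM K M (E i i s)
    E-diag∈ΛM {s = s} Mii≡0 s∈O = E∈ΛM (≡.subst (λ m → fin m ≤∞ val s) (≡.sym Mii≡0) s∈O)

    idMat∈ΛM : (∀ i → M i i ≡ + 0) → ΛM K M (idMat K)
    idMat∈ΛM M-diag = lift entry
      where
      entry : ∀ i j → fin (M i j) ≤∞ val (idMat K i j)
      entry i j with i ≟ j
      ... | yes ≡.refl = ≡.subst₂ _≤∞_ (≡.cong fin (≡.sym (M-diag i))) (≡.sym val-1#) ≤∞-refl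
      ... | no  _      = ≈0⇒≤∞-val refl

    triangle⇒ΛM-·ₘ-closed : (∀ i j k → M i k ℤ.≤ M i j ℤ.+ M j k) →
      ∀ X Y → ΛM K M X → ΛM K M Y → ΛM K M (X ·ₘ Y)
    triangle⇒ΛM-·ₘ-closed triangle X Y (lift X∈) (lift Y∈) = lift λ i k →
      val-∑-≥ _ (λ j → ≤∞-trans (fin≤fin (triangle i j k)) (val-*-≥ (X∈ i j) (Y∈ j k)))

    idempotent⇒triangle : (M ⊙ M) ≡ₘ M → ∀ i j k → M i k ℤ.≤ M i j ℤ.+ M j k
    idempotent⇒triangle idem i j k = ≡.subst (ℤ._≤ M i j ℤ.+ M j k) (idem i k) (minFin-≤ _ j)

  module Uniformizer (p : Carrier) (val-p : val p ≡ fin (+ 1)) where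

    p^_ : ℤ → Carrier
    p^ n = zpow K p n

    val-pow : ∀ n → val (pow K p n) ≡ fin (+ n)
    val-pow zero    = val-1#
    val-pow (suc n) = val-*-fin val-p (val-pow n)

    val-inv-pow : ∀ n → val (pow K (inv p) (suc n)) ≡ fin -[1+ n ]
    val-inv-pow zero    = val-*-fin (val-inv val-p) val-1#
    val-inv-pow (suc n) = val-*-fin (val-inv val-p) (val-inv-pow n)

    val-p^ : ∀ n → val (p^ n) ≡ fin n
    val-p^ (+ n)    = val-pow n
    val-p^ -[1+ n ] = val-inv-pow n

    p^-≉0 : ∀ n → ¬ p^ n ≈ 0#
    p^-≉0 n = val-fin⇒≉0 (val-p^ n)

    p^-≥ : ∀ n → fin n ≤∞ val (p^ n)
    p^-≥ n = ≤∞-reflexive (≡.sym (val-p^ n))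

    Lu⇒val-≥ : ∀ {d} (u : Fin d → ℤ) {x} → Lu K p u x → ∀ i → fin (u i) ≤∞ val (x i)
    Lu⇒val-≥ u {x} (a , a∈O , x≈) i = ≡.subst₂ _≤∞_ (≡.cong fin (ℤP.+-identityʳ (u i)))
      (≡.sym (val-cong (x≈ i))) (val-*-≥ (p^-≥ (u i)) (a∈O i))

    val-≥⇒Lu : ∀ {d} (u : Fin d → ℤ) {x} → (∀ i → fin (u i) ≤∞ val (x i)) → Lu K p u x
    val-≥⇒Lu u {x} u≤x =
      (λ i → inv (p^ u i) * x i) , (λ i → inv-*-∈O (val-p^ (u i)) (u≤x i)) ,
      λ i → sym (*-inv-cancelˡ (x i) (p^-≉0 (u i)))

    Lu-basis∈ : ∀ {d} (u : Fin d → ℤ) i → Lu K p u (e i (p^ u i))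
    Lu-basis∈ u i = val-≥⇒Lu u entry
      where
      entry : ∀ k → fin (u k) ≤∞ val (e i (p^ u i) k)
      entry k with k ≟ i
      ... | yes ≡.refl = p^-≥ (u i)
      ... | no  _      = ≈0⇒≤∞-val refl

    Lu-isLattice : ∀ {d} (u : Fin d → ℤ) → IsLattice K d (Lu K p u)
    Lu-isLattice {d} u = b , span , independent
      where
      b : Fin d → Vec K d
      b i = e i (p^ u i)
      combination : ∀ (a : Vec K d) k → ∑ d (λ i → a i * b i k) ≈ p^ u k * a k
      combination a k = trans (∑-*-e a (λ i → p^ u i) k) (*-comm _ _)
      span : Spans (Lu K p u) b
      span x = mk⇔ (λ (a , a∈O , x≈) → a , a∈O , λ k → trans (x≈ k) (sym (combination a k)))
                   (λ (a , a∈O , x≈) → a , a∈O , λ k → trans (x≈ k) (combination a k))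
      independent : ∀ a → (∀ i → O K (a i)) → (∀ k → ∑ d (λ i → a i * b i k) ≈ 0#) →
        ∀ i → a i ≈ 0#
      independent a _ sums-zero i =
        x*y≈0⇒x≈0 (trans (*-comm _ _) (trans (sym (combination a i)) (sums-zero i))) (p^-≉0 (u i))

    *-Lu : ∀ {d} (u w : Fin d → ℤ) {s a} → val s ≡ fin a → (∀ i → a ℤ.+ u i ≡ w i) →
      ∀ x → Lu K p u x → Lu K p w (λ i → s * x i)
    *-Lu u w {s} vs a+u≡w x x∈ = val-≥⇒Lu w λ i → ≡.subst (_≤∞ val (s * x i)) (≡.cong fin (a+u≡w i))
      (val-*-≥ (≤∞-reflexive (≡.sym vs)) (Lu⇒val-≥ u x∈ i))

    ∼⇒Lu-ΛIso : ∀ {d} {Λ : Mat K d → Set (c ⊔ ℓ)} (u v : Fin d → ℤ) → u ∼ v →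
      ΛIso K Λ (Lu K p u) (Lu K p v)
    ∼⇒Lu-ΛIso u v (t , u≡v+t) = scaling-ΛIso (p^-≉0 (ℤ.- t))
      (*-Lu u v (val-p^ (ℤ.- t)) down) (*-Lu v u (val-inv (val-p^ (ℤ.- t))) up)
      where
      down : ∀ i → ℤ.- t ℤ.+ u i ≡ v i
      down i = ≡.trans (≡.cong (ℤ._+_ (ℤ.- t)) (u≡v+t i)) (cancel t (v i))
        where
        cancel : ∀ t v → ℤ.- t ℤ.+ (v ℤ.+ t) ≡ v
        cancel = solve-∀
      up : ∀ i → ℤ.- (ℤ.- t) ℤ.+ v i ≡ u i
      up i = ≡.trans (cancel t (v i)) (≡.sym (u≡v+t i))
        where
        cancel : ∀ t v → ℤ.- (ℤ.- t) ℤ.+ v ≡ v ℤ.+ t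
        cancel = solve-∀

    module _ {d} (M : IntMat d) where

      ΛM-isMatLattice : IsMatLattice K d (ΛM K M)
      ΛM-isMatLattice = b , span , independent
        where
        b : Fin d → Fin d → Mat K d
        b i j = E i j (p^ M i j)
        combination : Mat K d → Mat K d
        combination a k l = ∑ d (λ i → ∑ d (λ j → a i j * b i j k l))
        expand : ∀ a k l → combination a k l ≈ a k l * p^ M k l
        expand a = ∑∑-*-E a (λ i j → p^ M i j)
        span : ∀ X → ΛM K M X ⇔ (∃ λ a → (∀ i j → O K (a i j)) × _≈m_ K X (combination a))
        span X = mk⇔
          (λ (lift M≤X) → (λ i j → inv (p^ M i j) * X i j) ,
                          (λ i j → inv-*-∈O (val-p^ (M i j)) (M≤X i j)) ,
                          λ k l → sym (trans (expand _ k l) (*-inv-cancelʳ (X k l) (p^-≉0 (M k l)))))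
          (λ (a , a∈O , X≈) → lift λ k l → ≡.subst₂ _≤∞_ (≡.cong fin (ℤP.+-identityˡ (M k l)))
                          (≡.sym (val-cong (trans (X≈ k l) (expand a k l))))
                          (val-*-≥ (a∈O k l) (p^-≥ (M k l))))
        independent : ∀ a → (∀ i j → O K (a i j)) → (∀ k l → combination a k l ≈ 0#) →
          ∀ i j → a i j ≈ 0#
        independent a _ sums-zero i j =
          x*y≈0⇒x≈0 (trans (sym (expand a i j)) (sums-zero i j)) (p^-≉0 (M i j))

      ΛM-closed⇒idempotent : (∀ i → M i i ≡ + 0) →
        (∀ X Y → ΛM K M X → ΛM K M Y → ΛM K M (X ·ₘ Y)) → (M ⊙ M) ≡ₘ M
      ΛM-closed⇒idempotent M-diag closed i k = ℤP.≤-antisym ⊙≤M M≤⊙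
        where
        ⊙≤M : (M ⊙ M) i k ℤ.≤ M i k
        ⊙≤M = ℤP.≤-trans (minFin-≤ _ i)
          (ℤP.≤-reflexive (≡.trans (≡.cong (ℤ._+ M i k) (M-diag i)) (ℤP.+-identityˡ _)))
        product-val : ∀ j → val ((E i j (p^ M i j) ·ₘ E j k (p^ M j k)) i k) ≡ fin (M i j ℤ.+ M j k)
        product-val j = ≡.trans
          (val-cong (trans (E-·ₘ-row i j (p^ M i j) (E j k (p^ M j k)) k) (*-congˡ (E-at j k _))))
          (val-*-fin (val-p^ (M i j)) (val-p^ (M j k)))
        M≤⊙ : M i k ℤ.≤ (M ⊙ M) i k
        M≤⊙ = minFin-glb _ i λ j → fin≤fin⁻¹ (≡.subst (fin (M i k) ≤∞_) (product-val j)
          (lower (closed _ _ (E∈ΛM M (p^-≥ _)) (E∈ΛM M (p^-≥ _))) i k))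

      idempotent⇒ΛM-isOrder : (∀ i → M i i ≡ + 0) → (M ⊙ M) ≡ₘ M → IsOrder K d (ΛM K M)
      idempotent⇒ΛM-isOrder M-diag idem =
        ΛM-isMatLattice , triangle⇒ΛM-·ₘ-closed M (idempotent⇒triangle M idem) , idMat∈ΛM M M-diag

      Lu-ΛM-stable : ∀ u → InQ M u → ∀ X x → ΛM K M X → Lu K p u x → Lu K p u (X ·ᵥ x)
      Lu-ΛM-stable u u∈Q X x (lift M≤X) x∈ = val-≥⇒Lu u λ i → val-∑-≥ _ λ j →
        ≤∞-trans (fin≤fin (-≤⇒≤+ (u∈Q i j))) (val-*-≥ (M≤X i j) (Lu⇒val-≥ u x∈ j))

      Lu-isΛLattice : ∀ u → InQ M u → IsΛLattice K d (ΛM K M) (Lu K p u)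
      Lu-isΛLattice u u∈Q = Lu-isLattice u , Lu-ΛM-stable u u∈Q

      module _ (M-diag : ∀ i → M i i ≡ + 0) where

        module _ (u v : Fin d → ℤ) (u∈Q : InQ M u) (iso : ΛIso K (ΛM K M) (Lu K p u) (Lu K p v)) where
          open ΛIso iso

          f-respects-E : ∀ {i j k β γ x y} (x∈ : Lu K p u x) (y∈ : Lu K p u y) →
            ΛM K M (E i j β) → ΛM K M (E i k γ) → β * x j ≈ γ * y k → β * f x x∈ j ≈ γ * f y y∈ k
          f-respects-E {i} {j} {k} {β} {γ} {x} {y} x∈ y∈ Eβ∈ Eγ∈ βx≈γy = begin
            β * f x x∈ j                    ≈⟨ E-·ᵥ-row i j β (f x x∈) ⟨
            (E i j β ·ᵥ f x x∈) i           ≈⟨ f-Λ _ x Eβ∈ x∈ Eβx∈ i ⟨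
            f (E i j β ·ᵥ x) Eβx∈ i         ≈⟨ f-cong _ _ Eβx∈ Eγy∈ same-vector i ⟩
            f (E i k γ ·ᵥ y) Eγy∈ i         ≈⟨ f-Λ _ y Eγ∈ y∈ Eγy∈ i ⟩
            (E i k γ ·ᵥ f y y∈) i           ≈⟨ E-·ᵥ-row i k γ (f y y∈) ⟩
            γ * f y y∈ k                    ∎
            where
            open SetoidReasoning setoid
            Eβx∈ : Lu K p u (E i j β ·ᵥ x)
            Eβx∈ = Lu-ΛM-stable u u∈Q _ x Eβ∈ x∈
            Eγy∈ : Lu K p u (E i k γ ·ᵥ y)
            Eγy∈ = Lu-ΛM-stable u u∈Q _ y Eγ∈ y∈
            same-vector : E i j β ·ᵥ x ≈ᵥ E i k γ ·ᵥ y
            same-vector l = trans (E-·ᵥ i j β x l) (trans (e-cong i βx≈γy l) (sym (E-·ᵥ i k γ y l)))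

          α : Fin d → Carrier
          α i = f (e i (p^ u i)) (Lu-basis∈ u i) i

          val-α : ∀ i → val (α i) ≡ fin (v i)
          val-α i = ≤∞-antisym α≤v (Lu⇒val-≥ v (f∈ _ (Lu-basis∈ u i)) i)
            where
            open SetoidReasoning setoid
            y : Vec K d
            y = g (e i (p^ v i)) (Lu-basis∈ v i)
            y∈ : Lu K p u y
            y∈ = g∈ (e i (p^ v i)) (Lu-basis∈ v i)
            s : Carrier
            s = inv (p^ u i) * y i
            s∈O : O K s
            s∈O = inv-*-∈O (val-p^ (u i)) (Lu⇒val-≥ u y∈ i)
            p^v≈sα : p^ v i ≈ s * α i
            p^v≈sα = begin
              p^ v i          ≈⟨ e-on i _ ⟨
              e i (p^ v i) i  ≈⟨ fg _ (Lu-basis∈ v i) i ⟨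
              f y y∈ i        ≈⟨ *-identityˡ _ ⟨
              1# * f y y∈ i   ≈⟨ f-respects-E y∈ (Lu-basis∈ u i) (E-diag∈ΛM M (M-diag i) O-1#)
                                   (E-diag∈ΛM M (M-diag i) s∈O)
                                   (trans (*-identityˡ _) (sym (trans (*-congˡ (e-on i _))
                                     (*-inv-cancelʳ (y i) (p^-≉0 (u i)))))) ⟩
              s * α i         ∎
            α≤v : val (α i) ≤∞ fin (v i)
            α≤v = ≤∞-trans (≤∞-+∞ˡ s∈O) (≤∞-reflexive
              (≡.trans (≡.sym (val-* s (α i))) (≡.trans (val-cong (sym p^v≈sα)) (val-p^ (v i)))))

          differences : ∀ i j → u i ℤ.- v i ≡ u j ℤ.- v j
          differences i j = differences-equal (u i) (v i) (u j) (v j) (M i j) (fin-injective vals)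
            where
            r : Carrier
            r = inv (p^ u i) * (p^ M i j * p^ u j)
            val-p^Mp^u : val (p^ M i j * p^ u j) ≡ fin (M i j ℤ.+ u j)
            val-p^Mp^u = val-*-fin (val-p^ (M i j)) (val-p^ (u j))
            r∈O : O K r
            r∈O = inv-*-∈O (val-p^ (u i))
              (≤∞-trans (fin≤fin (-≤⇒≤+ (u∈Q i j))) (≤∞-reflexive (≡.sym val-p^Mp^u)))
            related : p^ M i j * α j ≈ r * α i
            related = f-respects-E (Lu-basis∈ u j) (Lu-basis∈ u i)
              (E∈ΛM M (p^-≥ (M i j))) (E-diag∈ΛM M (M-diag i) r∈O)
              (trans (*-congˡ (e-on j _)) (sym (trans (*-congˡ (e-on i _)) (*-inv-cancelʳ _ (p^-≉0 (u i))))))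
            vals : fin (M i j ℤ.+ v j) ≡ fin ((ℤ.- u i ℤ.+ (M i j ℤ.+ u j)) ℤ.+ v i)
            vals = ≡.trans (≡.sym (val-*-fin (val-p^ (M i j)) (val-α j)))
              (≡.trans (val-cong related) (val-*-fin (val-*-fin (val-inv (val-p^ (u i))) val-p^Mp^u) (val-α i)))

          ΛIso⇒∼ : u ∼ v
          ΛIso⇒∼ = constant-difference⇒∼ u v differences

        module _ {L : Vec K d → Set (c ⊔ ℓ)} (L-lattice : IsLattice K d L)
                 (stable : ∀ X x → ΛM K M X → L x → L (X ·ᵥ x)) where

          b : Fin d → Vec K d
          b = proj₁ L-lattice

          span : Spans L b
          span = proj₁ (proj₂ L-lattice)

          coordinate-nonzero : ∀ i → ¬ (∀ x → L x → x i ≈ 0#)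
          coordinate-nonzero i row-zero = lattice-nonzero L-lattice i all-zero
            where
            all-zero : ∀ x → L x → x ≈ᵥ (λ _ → 0#)
            all-zero x x∈ l = x*y≈0⇒x≈0
              (trans (*-comm _ _) (trans (sym (E-·ᵥ-row i l _ x))
                (row-zero _ (stable _ x (E∈ΛM M (p^-≥ (M i l))) x∈))))
              (p^-≉0 (M i l))

          column-not-∞ : ∀ {i j} → (∀ k → val (b j i) ≤∞ val (b k i)) → val (b j i) ≢ ∞
          column-not-∞ {i} j-min vj≡∞ = coordinate-nonzero i λ x x∈ →
            to (val-∞ (x i))
               (∞≤⇒≡∞ (coordinate-≥ span (λ k → ≡.subst (_≤∞ val (b k i)) vj≡∞ (j-min k)) x∈))

          column-min : ∀ i → ∃ λ j → ∃ λ n → val (b j i) ≡ fin n × (∀ k → fin n ≤∞ val (b k i))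
          column-min i with argmin i (λ j → val (b j i))
          ... | j , j-min with ℤ∞-finite (val (b j i)) (column-not-∞ j-min)
          ... | n , vj≡n = j , n , vj≡n , λ k → ≡.subst (_≤∞ val (b k i)) vj≡n (j-min k)

          pivot : Fin d → Fin d
          pivot i = proj₁ (column-min i)

          u : Fin d → ℤ
          u i = proj₁ (proj₂ (column-min i))

          val-pivot : ∀ i → val (b (pivot i) i) ≡ fin (u i)
          val-pivot i = proj₁ (proj₂ (proj₂ (column-min i)))

          pivot-min : ∀ i k → fin (u i) ≤∞ val (b k i)
          pivot-min i = proj₂ (proj₂ (proj₂ (column-min i)))

          L⊆Lu : ∀ x → L x → Lu K p u x
          L⊆Lu x x∈ = val-≥⇒Lu u λ i → coordinate-≥ span (pivot-min i) x∈

          Lu⊆L : ∀ x → Lu K p u x → L x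
          Lu⊆L x x∈ = ∈-resp-≈ᵥ span decomposition (∑-closed span d pieces pieces∈)
            where
            s : Fin d → Carrier
            s i = inv (b (pivot i) i) * x i
            pieces : Fin d → Vec K d
            pieces i = E i i (s i) ·ᵥ b (pivot i)
            pieces∈ : ∀ i → L (pieces i)
            pieces∈ i = stable _ _ (E-diag∈ΛM M (M-diag i) (inv-*-∈O (val-pivot i) (Lu⇒val-≥ u x∈ i)))
              (basis∈ span (pivot i))
            decomposition : (λ k → ∑ d (λ i → pieces i k)) ≈ᵥ x
            decomposition k = trans (∑-cong (λ i → trans (E-·ᵥ i i (s i) _ k)
                (e-cong i (*-inv-cancelʳ (x i) (val-fin⇒≉0 (val-pivot i))) k)))
              (∑-e x k)

          u∈Q : InQ M u
          u∈Q i j = ≤+⇒-≤ (fin≤fin⁻¹ (≡.subst (fin (u i) ≤∞_) val-yi (Lu⇒val-≥ u (L⊆Lu y y∈) i)))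
            where
            y : Vec K d
            y = E i j (p^ M i j) ·ᵥ b (pivot j)
            y∈ : L y
            y∈ = stable _ _ (E∈ΛM M (p^-≥ (M i j))) (basis∈ span (pivot j))
            val-yi : val (y i) ≡ fin (M i j ℤ.+ u j)
            val-yi = ≡.trans (val-cong (E-·ᵥ-row i j _ _)) (val-*-fin (val-p^ (M i j)) (val-pivot j))

          ΛLattice-classified : ∃ λ u → InQ M u × ΛIso K (ΛM K M) L (Lu K p u)
          ΛLattice-classified = u , u∈Q , ⊆⊇⇒ΛIso L⊆Lu Lu⊆L

-- The second and third parts hold whether or not Λ_M is an order.
mainTheorem2 : ∀ {c ℓ} (K : DVField c ℓ) (p : DVField.Carrier K) → DVField.val K p ≡ fin (+ 1) →
    (d : ℕ) (M : IntMat d) → (∀ i → M i i ≡ + 0) →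
      (IsOrder K d (ΛM K M) ⇔ (M ⊙ M) ≡ₘ M)
      × ((M ⊙ M) ≡ₘ M →
          (∀ u → InQ M u → IsΛLattice K d (ΛM K M) (Lu K p u))
          × (∀ u v → InQ M u → InQ M v → (ΛIso K (ΛM K M) (Lu K p u) (Lu K p v) ⇔ u ∼ v))
          × (∀ L → IsΛLattice K d (ΛM K M) L →
               ∃ λ u → InQ M u × ΛIso K (ΛM K M) L (Lu K p u)))
mainTheorem2 K p val-p d M M-diag =
    mk⇔ (λ (_ , closed , _) → ΛM-closed⇒idempotent M M-diag closed) (idempotent⇒ΛM-isOrder M M-diag)
  , λ _ → (λ u → Lu-isΛLattice M u)
        , (λ u v u∈Q _ → mk⇔ (ΛIso⇒∼ M M-diag u v u∈Q) (∼⇒Lu-ΛIso u v))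
        , λ _ (L-lattice , stable) → ΛLattice-classified M M-diag L-lattice stable
  where
  open Theory K
  open Uniformizer p val-p
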